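{- Let $x[1..n]$ be a framed word as described in the context. For every $i\in[1,n]$, let $z=x[i..i+\lambda^{ -1}[i]-1]$ be the maximal inverse Lyndon subword of $x$ starting at position $i$, and let $\mathrm{border}(z)$ denote the length of the longest proper border of $z$. Then \[ \mathit{next}_{ -1}[i] = i + \lambda^{ -1}[i] - \mathrm{border}(z). \]
   Context: Let $(\Sigma,<)$ be a totally ordered alphabet. The lexicographic order $\prec$ on words is: $u\prec v$ iff either $v=uw$ for some non-empty word $w$, or $u=ary$, $v=asy'$ for words $a,y,y'$ and letters $r<s$. A framed word is a word $x[1..n]$ ($n\ge 2$) with $x[1]=\#$, $x[n]=\$$ and $x[2..n-1]\in\Sigma^*$, where the order on $\Sigma$ is extended by $\# > \$ > a$ for all $a\in\Sigma$. For $1\le i\le n$, $x_i=x[i..n]$ is the suffix starting at $i$. A non-empty word $w$ is an inverse Lyndon word if $s\prec w$ for every non-empty proper suffix $s$ of $w$. A subword $x[i..j]$ is a maximal inverse Lyndon subword starting at $i$ if it is an inverse Lyndon word and either $j=n$ or $x[i..j+1]$ is not an inverse Lyndon word. The inverse Lyndon array is $\lambda^{ -1}[i]=\max\{m\in[1,n-i+1]\mid x[i..i+m-1]\text{ is an inverse Lyndon word}\}$. The next greater suffix array is $\mathit{next}_{ -1}[i]=\min\{j\in(i,n]\mid x_j\succ x_i\}$, with the conventions $\mathit{next}_{ -1}[1]=\mathit{next}_{ -1}[n]=n+1$. A border of a word $z$ is a word that is both a proper prefix and a proper suffix of $z$ (possibly empty). -}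

module Defs where

open import Data.Nat using (ℕ; zero; suc; _+_; _∸_; _≤_; _<_)
open import Data.List using (List; []; _∷_; _++_; [_]; map; length; take; drop)
open import Data.Product using (Σ; ∃; _×_; _,_)
open import Data.Sum using (_⊎_)
open import Relation.Nullary using (¬_)
open import Relation.Binary.PropositionalEquality using (_≡_; _≢_)

data Frame (A : Set) : Set where
  hash   : Frame A
  dollar : Frame A
  letter : A → Frame A

module Words {A : Set} (_⋖_ : A → A → Set) where

  data _<F_ : Frame A → Frame A → Set where
    let<let : ∀ {a b} → a ⋖ b → letter a <F letter b
    let<$   : ∀ {a} → letter a <F dollar
    let<#   : ∀ {a} → letter a <F hash
    $<#     : dollar <F hash

  Word : Set
  Word = List (Frame A)

  _≺_ : Word → Word → Set
  u ≺ v = (∃ λ w → w ≢ [] × v ≡ u ++ w)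
        ⊎ (∃ λ a → ∃ λ r → ∃ λ s → ∃ λ y → ∃ λ y' →
             r <F s × u ≡ a ++ (r ∷ y) × v ≡ a ++ (s ∷ y'))

  Framed : Word → Set
  Framed x = ∃ λ w → x ≡ hash ∷ (map letter w ++ [ dollar ])

  InvLyndon : Word → Set
  InvLyndon w = w ≢ [] × (∀ p s → p ≢ [] → s ≢ [] → w ≡ p ++ s → s ≺ w)

  -- 1-based positions: suffix x_i = x[i..n], and sub x i m = x[i..i+m-1]
  suffix : Word → ℕ → Word
  suffix x i = drop (i ∸ 1) x

  sub : Word → ℕ → ℕ → Word
  sub x i m = take m (drop (i ∸ 1) x)

  IsInvLyndonArray : Word → ℕ → ℕ → Set
  IsInvLyndonArray x i m =
    1 ≤ m × m ≤ (length x ∸ i) + 1 × InvLyndon (sub x i m) ×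
    (∀ m' → 1 ≤ m' → m' ≤ (length x ∸ i) + 1 → InvLyndon (sub x i m') → m' ≤ m)

  IsNextGreater : Word → ℕ → ℕ → Set
  IsNextGreater x i j =
    ((i ≡ 1 ⊎ i ≡ length x) × j ≡ suc (length x))
    ⊎ (1 < i × i < length x × i < j × j ≤ length x ×
       suffix x i ≺ suffix x j ×
       (∀ k → i < k → k < j → ¬ (suffix x i ≺ suffix x k)))

  Border : Word → Word → Set
  Border u z = (∃ λ w → w ≢ [] × z ≡ u ++ w) × (∃ λ w → w ≢ [] × z ≡ w ++ u)

  IsLongestBorderLength : Word → ℕ → Set
  IsLongestBorderLength z b =
    (∃ λ u → Border u z × length u ≡ b) × (∀ u → Border u z → length u ≤ b)

-- At an interior position i, z = x[i..i+m-1] is followed by a letter c (the suffix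
-- x_i, ending in $, is not inverse Lyndon). Write z = u d z″ = u₀ u with u its longest
-- border. If c ≤ d, then z c would be inverse Lyndon: a mismatch s ⊏ z survives appending
-- c, and a suffix s that is a prefix of z is a border, so the letter after it is ≥ d ≥ c.
-- Maximality therefore forces d < c, whence x_{i+|u₀|} = u c … ≻ u d … = x_i. For
-- 0 < t < |u₀| the suffix drop t z is longer than u, so it is no border and lies below z
-- at a mismatch, which x_{i+t} inherits. So next_{-1}[i] = i + |u₀| = i + m − border(z).
-- At i = 1 the whole word is inverse Lyndon and borderless (# is the largest letter and
-- occurs once); at i = n, m = 1.
module Submission where

open import Defs
open import Data.Nat using (ℕ; zero; suc; _+_; _∸_; _≤_; _<_; z≤n; s≤s; s≤s⁻¹)
open import Data.Nat.Properties
open import Data.List using (List; []; _∷_; _++_; [_]; map; length; take; drop)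
open import Data.List.Properties
  using (∷-injectiveˡ; ∷-injectiveʳ; ++-assoc; ++-cancelˡ; ++-conicalʳ;
         length-++; length-take; length-drop; take++drop≡id; take-all; drop-drop)
open import Data.Product using (∃; ∃₂; _×_; _,_; proj₁; proj₂)
open import Data.Sum using (_⊎_; inj₁; inj₂)
open import Data.Empty using (⊥; ⊥-elim)
open import Function using (_∘_)
open import Relation.Nullary using (¬_)
open import Relation.Binary.PropositionalEquality hiding ([_])
open import Relation.Binary.Structures using (IsStrictTotalOrder)
open import Relation.Binary.Definitions using (tri<; tri≈; tri>)

module _ {T : Set} where

  ++-∷-≢[] : ∀ (xs : List T) {y ys} → xs ++ y ∷ ys ≢ []
  ++-∷-≢[] []      ()
  ++-∷-≢[] (_ ∷ _) ()

  ≢[]⇒length>0 : ∀ {xs : List T} → xs ≢ [] → 0 < length xs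
  ≢[]⇒length>0 {[]}    xs≢[] = ⊥-elim (xs≢[] refl)
  ≢[]⇒length>0 {_ ∷ _} _     = s≤s z≤n

  take-≢[] : ∀ t (xs : List T) → 0 < t → xs ≢ [] → take t xs ≢ []
  take-≢[] (suc t) []      _ xs≢[] = xs≢[]
  take-≢[] (suc t) (_ ∷ _) _ _     = λ ()

  drop-++ˡ : ∀ t (xs : List T) {ys} → t ≤ length xs → drop t (xs ++ ys) ≡ drop t xs ++ ys
  drop-++ˡ zero    xs       _         = refl
  drop-++ˡ (suc t) (_ ∷ xs) (s≤s t≤n) = drop-++ˡ t xs t≤n

  drop-length-++ : ∀ (xs : List T) {ys} → drop (length xs) (xs ++ ys) ≡ ys
  drop-length-++ []       = refl
  drop-length-++ (_ ∷ xs) = drop-length-++ xs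

  ++-split-≤ : ∀ (a b c d : List T) → a ++ b ≡ c ++ d → length a ≤ length c →
               ∃ λ e → c ≡ a ++ e × b ≡ e ++ d
  ++-split-≤ []      b c       d eq _ = c , refl , eq
  ++-split-≤ (_ ∷ _) _ []      _ _  ()
  ++-split-≤ (x ∷ a) b (y ∷ c) d eq (s≤s a≤c)
    with ++-split-≤ a b c d (∷-injectiveʳ eq) a≤c
  ... | e , c≡ae , b≡ed = e , cong₂ _∷_ (sym (∷-injectiveˡ eq)) c≡ae , b≡ed

  snoc-split : ∀ (z p s : List T) {c} → z ++ [ c ] ≡ p ++ s → s ≢ [] →
               ∃ λ s₀ → s ≡ s₀ ++ [ c ] × z ≡ p ++ s₀
  snoc-split z       []      s eq _     = z , sym eq , refl
  snoc-split []      (_ ∷ p) s eq s≢[] = ⊥-elim (s≢[] (++-conicalʳ p s (sym (∷-injectiveʳ eq))))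
  snoc-split (x ∷ z) (_ ∷ p) s eq s≢[] with snoc-split z p s (∷-injectiveʳ eq) s≢[]
  ... | s₀ , s≡ , z≡ = s₀ , s≡ , cong₂ _∷_ (∷-injectiveˡ eq) z≡

  take-suc-view : ∀ m (xs : List T) → m < length xs →
    ∃₂ λ c R → xs ≡ take m xs ++ c ∷ R × take (suc m) xs ≡ take m xs ++ [ c ]
  take-suc-view zero    (c ∷ R)  _         = c , R , refl , refl
  take-suc-view (suc m) (x ∷ xs) (s≤s m<n) with take-suc-view m xs m<n
  ... | c , R , xs≡ , take≡ = c , R , cong (x ∷_) xs≡ , cong (x ∷_) take≡

module InverseLyndon {A : Set} (_⋖_ : A → A → Set) (sto : IsStrictTotalOrder _≡_ _⋖_) where
  open Words _⋖_
  open IsStrictTotalOrder sto using (compare) renaming (irrefl to ⋖-irrefl; trans to ⋖-trans)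

  _≤F_ : Frame A → Frame A → Set
  e ≤F f = e ≡ f ⊎ e <F f

  <F-irrefl : ∀ {e} → ¬ e <F e
  <F-irrefl (let<let a⋖a) = ⋖-irrefl refl a⋖a

  <F-trans : ∀ {e f g} → e <F f → f <F g → e <F g
  <F-trans (let<let a⋖b) (let<let b⋖c) = let<let (⋖-trans a⋖b b⋖c)
  <F-trans (let<let _)   let<$          = let<$
  <F-trans (let<let _)   let<#          = let<#
  <F-trans let<$         $<#            = let<#

  <-≤F-trans : ∀ {e f g} → e <F f → f ≤F g → e <F g
  <-≤F-trans e<f (inj₁ refl) = e<f
  <-≤F-trans e<f (inj₂ f<g)  = <F-trans e<f f<g

  <F-compare : ∀ e f → e <F f ⊎ f ≤F e
  <F-compare hash       hash       = inj₂ (inj₁ refl)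
  <F-compare hash       dollar     = inj₂ (inj₂ $<#)
  <F-compare hash       (letter _) = inj₂ (inj₂ let<#)
  <F-compare dollar     hash       = inj₁ $<#
  <F-compare dollar     dollar     = inj₂ (inj₁ refl)
  <F-compare dollar     (letter _) = inj₂ (inj₂ let<$)
  <F-compare (letter _) hash       = inj₁ let<#
  <F-compare (letter _) dollar     = inj₁ let<$
  <F-compare (letter a) (letter b) with compare a b
  ... | tri< a⋖b _ _ = inj₁ (let<let a⋖b)
  ... | tri≈ _ a≡b _ = inj₂ (inj₁ (cong letter (sym a≡b)))
  ... | tri> _ _ b⋖a = inj₂ (inj₂ (let<let b⋖a))

  _⊏_ : Word → Word → Set
  u ⊏ v = ∃ λ a → ∃ λ r → ∃ λ s → ∃ λ y → ∃ λ y′ →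
            r <F s × u ≡ a ++ (r ∷ y) × v ≡ a ++ (s ∷ y′)

  ⊏-++ : ∀ {u v p q} → u ⊏ v → (u ++ p) ⊏ (v ++ q)
  ⊏-++ {p = p} {q} (a , r , s , y , y′ , r<s , refl , refl) =
    a , r , s , y ++ p , y′ ++ q , r<s , ++-assoc a (r ∷ y) p , ++-assoc a (s ∷ y′) q

  ∷-≺⁻ : ∀ {e u v} → (e ∷ u) ≺ (e ∷ v) → u ≺ v
  ∷-≺⁻ (inj₁ (w , w≢[] , eq)) = inj₁ (w , w≢[] , ∷-injectiveʳ eq)
  ∷-≺⁻ (inj₂ ([] , _ , _ , _ , _ , r<r , refl , refl)) = ⊥-elim (<F-irrefl r<r)
  ∷-≺⁻ (inj₂ (_ ∷ a , r , s , y , y′ , r<s , u≡ , v≡)) =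
    inj₂ (a , r , s , y , y′ , r<s , ∷-injectiveʳ u≡ , ∷-injectiveʳ v≡)

  mismatch-¬≺ : ∀ a {r s y y′} → r <F s → ¬ (a ++ s ∷ y′) ≺ (a ++ r ∷ y)
  mismatch-¬≺ [] r<r (inj₁ (_ , _ , refl)) = <F-irrefl r<r
  mismatch-¬≺ [] r<s (inj₂ ([] , _ , _ , _ , _ , s<r , refl , refl)) = <F-irrefl (<F-trans r<s s<r)
  mismatch-¬≺ [] r<r (inj₂ (_ ∷ _ , _ , _ , _ , _ , _ , refl , refl)) = <F-irrefl r<r
  mismatch-¬≺ (_ ∷ a) r<s = mismatch-¬≺ a r<s ∘ ∷-≺⁻

  ⊏⇒¬≻ : ∀ {u v} → u ⊏ v → ¬ v ≺ u
  ⊏⇒¬≻ (a , _ , _ , _ , _ , r<s , refl , refl) = mismatch-¬≺ a r<s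

  invLyndon-suffix-view : ∀ {z p s} → InvLyndon z → p ≢ [] → z ≡ p ++ s →
                          s ⊏ z ⊎ ∃₂ λ e w → z ≡ s ++ e ∷ w
  invLyndon-suffix-view {[]}    (z≢[] , _) _ _ = ⊥-elim (z≢[] refl)
  invLyndon-suffix-view {e ∷ w} {s = []} _ _ _ = inj₂ (e , w , refl)
  invLyndon-suffix-view {_ ∷ _} {p} {s@(_ ∷ _)} (_ , suffix≺) p≢[] z≡ps
    with suffix≺ p s p≢[] (λ ()) z≡ps
  ... | inj₂ s⊏z                  = inj₁ s⊏z
  ... | inj₁ ([] , []≢[] , _)      = ⊥-elim ([]≢[] refl)
  ... | inj₁ (e ∷ w , _ , z≡sew)   = inj₂ (e , w , z≡sew)

  border-shorter : ∀ {u z} → Border u z → length u < length z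
  border-shorter {u} ((w , w≢[] , z≡uw) , _) =
    subst (length u <_) (sym (trans (cong length z≡uw) (length-++ u)))
          (m<m+n (length u) (≢[]⇒length>0 w≢[]))

  module LongestBorder {z u₀ u z″ : Word} {d : Frame A} (il : InvLyndon z)
                       (longest : ∀ v → Border v z → length v ≤ length u)
                       (z≡u₀u : z ≡ u₀ ++ u) (z≡udz : z ≡ u ++ d ∷ z″) where

    length-z : length z ≡ length u₀ + length u
    length-z = trans (cong length z≡u₀u) (length-++ u₀)

    -- A border s shorter than u is a suffix of u, so s d z″ is a proper suffix of z;
    -- if the letter after s were below d, z = s e … would lie below that suffix.
    border-successor-≮ : ∀ {p s e w} → p ≢ [] → z ≡ p ++ s → z ≡ s ++ e ∷ w → ¬ e <F d
    border-successor-≮ {p} {s} {e} {w} p≢[] z≡ps z≡sew e<d =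
      from-split (++-split-≤ u₀ u p s (trans (sym z≡u₀u) z≡ps) |u₀|≤|p|)
      where
        |s|≤|u| : length s ≤ length u
        |s|≤|u| = longest s ((e ∷ w , (λ ()) , z≡sew) , (p , p≢[] , z≡ps))

        |u₀|≤|p| : length u₀ ≤ length p
        |u₀|≤|p| = +-cancelʳ-≤ (length u) (length u₀) (length p) (begin
          length u₀ + length u  ≡⟨ sym length-z ⟩
          length z              ≡⟨ cong length z≡ps ⟩
          length (p ++ s)       ≡⟨ length-++ p ⟩
          length p + length s   ≤⟨ +-monoʳ-≤ (length p) |s|≤|u| ⟩
          length p + length u   ∎)
          where open ≤-Reasoning

        from-split : (∃ λ f → p ≡ u₀ ++ f × u ≡ f ++ s) → ⊥
        from-split ([] , _ , u≡s) = <F-irrefl (subst (e <F_) d≡e e<d)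
          where
            d≡e : d ≡ e
            d≡e = ∷-injectiveˡ (++-cancelˡ s _ _
                    (trans (sym (trans z≡udz (cong (_++ d ∷ z″) u≡s))) z≡sew))
        from-split (f ∷ fs , _ , u≡fs) =
          ⊏⇒¬≻ z⊏ (proj₂ il (f ∷ fs) (s ++ d ∷ z″) (λ ()) (++-∷-≢[] s) z≡)
          where
            z⊏ : z ⊏ (s ++ d ∷ z″)
            z⊏ = s , e , d , w , z″ , e<d , z≡sew , refl
            z≡ : z ≡ (f ∷ fs) ++ (s ++ d ∷ z″)
            z≡ = trans z≡udz (trans (cong (_++ d ∷ z″) u≡fs) (++-assoc (f ∷ fs) s (d ∷ z″)))

    suffix-snoc-≺ : ∀ {c p s} → c ≤F d → p ≢ [] → z ≡ p ++ s → (s ++ [ c ]) ≺ (z ++ [ c ])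
    suffix-snoc-≺ {c} {p} {s} c≤d p≢[] z≡ps with invLyndon-suffix-view il p≢[] z≡ps
    ... | inj₁ s⊏z = inj₂ (⊏-++ s⊏z)
    ... | inj₂ (e , w , z≡sew) with <F-compare c e
    ...   | inj₁ c<e = inj₂ (s , c , e , [] , w ++ [ c ] , c<e , refl ,
                             trans (cong (_++ [ c ]) z≡sew) (++-assoc s (e ∷ w) [ c ]))
    ...   | inj₂ (inj₁ refl) = inj₁ (w ++ [ c ] , ++-∷-≢[] w ,
                             trans (cong (_++ [ c ]) z≡sew)
                               (trans (++-assoc s (c ∷ w) [ c ]) (sym (++-assoc s [ c ] (w ++ [ c ])))))
    ...   | inj₂ (inj₂ e<c) = ⊥-elim (border-successor-≮ p≢[] z≡ps z≡sew (<-≤F-trans e<c c≤d))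

    snoc-invLyndon : ∀ {c} → c ≤F d → InvLyndon (z ++ [ c ])
    snoc-invLyndon {c} c≤d = ++-∷-≢[] z , proper-suffix-≺
      where
        proper-suffix-≺ : ∀ p s → p ≢ [] → s ≢ [] → z ++ [ c ] ≡ p ++ s → s ≺ (z ++ [ c ])
        proper-suffix-≺ p s p≢[] s≢[] eq with snoc-split z p s eq s≢[]
        ... | s₀ , refl , z≡ps₀ = suffix-snoc-≺ c≤d p≢[] z≡ps₀

    ≺-shift-period : ∀ {c R} → d <F c → (z ++ c ∷ R) ≺ drop (length u₀) (z ++ c ∷ R)
    ≺-shift-period {c} {R} d<c = inj₂ (u , d , c , z″ ++ c ∷ R , R , d<c ,
      trans (cong (_++ c ∷ R) z≡udz) (++-assoc u (d ∷ z″) (c ∷ R)) , shifted)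
      where
        shifted : drop (length u₀) (z ++ c ∷ R) ≡ u ++ c ∷ R
        shifted = begin
          drop (length u₀) (z ++ c ∷ R)         ≡⟨ cong (λ y → drop (length u₀) (y ++ c ∷ R)) z≡u₀u ⟩
          drop (length u₀) ((u₀ ++ u) ++ c ∷ R) ≡⟨ cong (drop (length u₀)) (++-assoc u₀ u (c ∷ R)) ⟩
          drop (length u₀) (u₀ ++ u ++ c ∷ R)   ≡⟨ drop-length-++ u₀ ⟩
          u ++ c ∷ R                            ∎
          where open ≡-Reasoning

    -- drop t z is longer than u, so it cannot be a border: it is below z at a mismatch.
    ¬≺-shift-within : ∀ {c R} t → 0 < t → t < length u₀ → ¬ (z ++ c ∷ R) ≺ drop t (z ++ c ∷ R)
    ¬≺-shift-within {c} {R} t 0<t t<|u₀| z≺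
      with invLyndon-suffix-view il (take-≢[] t z 0<t (proj₁ il)) (sym (take++drop≡id t z))
    ... | inj₁ v⊏z = ⊏⇒¬≻ (⊏-++ v⊏z) (subst ((z ++ c ∷ R) ≺_) (drop-++ˡ t z t≤|z|) z≺)
      where
        t≤|z| : t ≤ length z
        t≤|z| = subst (t ≤_) (sym length-z) (≤-trans (<⇒≤ t<|u₀|) (m≤m+n (length u₀) (length u)))
    ... | inj₂ (e , w , z≡vew) =
      <⇒≱ |u|<|v| (longest (drop t z) ((e ∷ w , (λ ()) , z≡vew) ,
                    (take t z , take-≢[] t z 0<t (proj₁ il) , sym (take++drop≡id t z))))
      where
        |u|<|v| : length u < length (drop t z)
        |u|<|v| = subst (length u <_) (sym (length-drop t z)) (m+n≤o⇒m≤o∸n (suc (length u)) (begin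
          suc (length u + t)   ≡⟨ cong suc (+-comm (length u) t) ⟩
          suc t + length u     ≤⟨ +-monoˡ-≤ (length u) t<|u₀| ⟩
          length u₀ + length u ≡⟨ sym length-z ⟩
          length z             ∎))
          where open ≤-Reasoning

  next-greater-period : ∀ {X z c R} b t → X ≡ z ++ c ∷ R → InvLyndon z → ¬ InvLyndon (z ++ [ c ]) →
    IsLongestBorderLength z b → 0 < t → X ≺ drop t X →
    (∀ t′ → 0 < t′ → t′ < t → ¬ X ≺ drop t′ X) →
    t + b ≡ length z
  next-greater-period _ _ _ _ _ ((_ , (([] , []≢[] , _) , _) , _) , _) _ _ _ = ⊥-elim ([]≢[] refl)
  next-greater-period {z = z} {c} _ t refl il ¬il′
    ((u , ((d ∷ z″ , _ , z≡udz) , (u₀ , u₀≢[] , z≡u₀u)) , refl) , longest) 0<t next minimal =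
    trans (cong (_+ length u) t≡|u₀|) (sym length-z)
    where
      open LongestBorder {u₀ = u₀} il longest z≡u₀u z≡udz

      d<c : d <F c
      d<c with <F-compare d c
      ... | inj₁ d<c = d<c
      ... | inj₂ c≤d = ⊥-elim (¬il′ (snoc-invLyndon c≤d))

      t≡|u₀| : t ≡ length u₀
      t≡|u₀| with <-cmp t (length u₀)
      ... | tri< t<|u₀| _ _ = ⊥-elim (¬≺-shift-within t 0<t t<|u₀| next)
      ... | tri≈ _ t≡|u₀| _ = t≡|u₀|
      ... | tri> _ _ |u₀|<t =
        ⊥-elim (minimal (length u₀) (≢[]⇒length>0 u₀≢[]) |u₀|<t (≺-shift-period d<c))

  length-suffix : ∀ (x : Word) i → 1 ≤ i → i ≤ length x → length (suffix x i) ≡ length x ∸ i + 1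
  length-suffix x (suc i) _ i<n = begin
    length (drop i x)        ≡⟨ length-drop i x ⟩
    length x ∸ i             ≡⟨ cong (_∸ suc i) (+-comm 1 (length x)) ⟩
    length x + 1 ∸ suc i     ≡⟨ +-∸-comm 1 i<n ⟩
    length x ∸ suc i + 1     ∎
    where open ≡-Reasoning

  suffix-+ : ∀ (x : Word) i t → 1 ≤ i → suffix x (i + t) ≡ drop t (suffix x i)
  suffix-+ x (suc i) t _ = sym (drop-drop i t x)

  next-greater≡period : ∀ x i m b j → 1 ≤ i → i ≤ length x → ¬ InvLyndon (suffix x i) →
    IsInvLyndonArray x i m → IsLongestBorderLength (sub x i m) b →
    i < j → suffix x i ≺ suffix x j → (∀ k → i < k → k < j → ¬ (suffix x i ≺ suffix x k)) →
    j ≡ i + m ∸ b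
  next-greater≡period x i m b j 1≤i i≤n ¬il (_ , m≤ , il , maximal) border i<j next minimal = begin
    j                  ≡⟨ sym i+t≡j ⟩
    i + t              ≡⟨ sym (m+n∸n≡m (i + t) b) ⟩
    i + t + b ∸ b      ≡⟨ cong (_∸ b) (+-assoc i t b) ⟩
    i + (t + b) ∸ b    ≡⟨ cong (λ n → i + n ∸ b) t+b≡m ⟩
    i + m ∸ b          ∎
    where
      open ≡-Reasoning
      X : Word
      X = suffix x i

      t : ℕ
      t = j ∸ i

      i+t≡j : i + t ≡ j
      i+t≡j = m+[n∸m]≡n (<⇒≤ i<j)

      |X| : length X ≡ length x ∸ i + 1
      |X| = length-suffix x i 1≤i i≤n

      m<|X| : m < length X
      m<|X| = ≤∧≢⇒< (subst (m ≤_) (sym |X|) m≤)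
                (λ m≡|X| → ¬il (subst InvLyndon (take-all m X (≤-reflexive (sym m≡|X|))) il))

      ¬il′ : ¬ InvLyndon (take (suc m) X)
      ¬il′ il′ = <-irrefl refl (maximal (suc m) (s≤s z≤n) (subst (suc m ≤_) |X| m<|X|) il′)

      next′ : X ≺ drop t X
      next′ = subst (X ≺_) (trans (cong (suffix x) (sym i+t≡j)) (suffix-+ x i t 1≤i)) next

      minimal′ : ∀ t′ → 0 < t′ → t′ < t → ¬ X ≺ drop t′ X
      minimal′ t′ 0<t′ t′<t =
        minimal (i + t′) (m<m+n i 0<t′) (subst (i + t′ <_) i+t≡j (+-monoʳ-< i t′<t))
        ∘ subst (X ≺_) (sym (suffix-+ x i t′ 1≤i))

      t+b≡m : t + b ≡ m
      t+b≡m with take-suc-view m X m<|X|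
      ... | c , R , X≡ , take-suc≡ =
        trans (next-greater-period b t X≡ il (¬il′ ∘ subst InvLyndon (sym take-suc≡)) border
                 (m<n⇒0<n∸m i<j) next′ minimal′)
              (trans (length-take m X) (m≤n⇒m⊓n≡m (<⇒≤ m<|X|)))

  next-greater-last : ∀ x m b → IsInvLyndonArray x (length x) m →
    IsLongestBorderLength (sub x (length x) m) b → length x + m ∸ b ≡ suc (length x)
  next-greater-last x m _ (1≤m , m≤0+1 , _) ((u , border , refl) , _) = begin
    length x + m ∸ length u  ≡⟨ cong₂ (λ k l → length x + k ∸ l) m≡1 |u|≡0 ⟩
    length x + 1             ≡⟨ +-comm (length x) 1 ⟩
    suc (length x)           ∎
    where
      open ≡-Reasoning
      m≤1 : m ≤ 1
      m≤1 = subst (λ k → m ≤ k + 1) (n∸n≡0 (length x)) m≤0+1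

      m≡1 : m ≡ 1
      m≡1 = ≤-antisym m≤1 1≤m

      |u|≡0 : length u ≡ 0
      |u|≡0 = n≤0⇒n≡0 (s≤s⁻¹ (≤-trans (border-shorter border)
                (≤-trans (subst (_≤ m) (sym (length-take m _)) (m⊓n≤m m _)) m≤1)))

  body : List A → Word
  body w = map letter w ++ [ dollar ]

  body-<F-hash : ∀ w p {e r} → body w ≡ p ++ e ∷ r → e <F hash
  body-<F-hash []      []          refl = $<#
  body-<F-hash (_ ∷ _) []          refl = let<#
  body-<F-hash []      (_ ∷ [])    ()
  body-<F-hash []      (_ ∷ _ ∷ _) ()
  body-<F-hash (_ ∷ w) (_ ∷ p)     eq   = body-<F-hash w p (∷-injectiveʳ eq)

  hash∷body-invLyndon : ∀ w → InvLyndon (hash ∷ body w)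
  hash∷body-invLyndon w = (λ ()) , suffix≺
    where
      suffix≺ : ∀ p s → p ≢ [] → s ≢ [] → hash ∷ body w ≡ p ++ s → s ≺ (hash ∷ body w)
      suffix≺ []      _       p≢[] _    _  = ⊥-elim (p≢[] refl)
      suffix≺ (_ ∷ _) []      _    s≢[] _  = ⊥-elim (s≢[] refl)
      suffix≺ (_ ∷ p) (e ∷ r) _    _    eq =
        inj₂ ([] , e , hash , r , body w , body-<F-hash w p (∷-injectiveʳ eq) , refl , refl)

  hash∷body-borderless : ∀ w {u} → Border u (hash ∷ body w) → length u ≡ 0
  hash∷body-borderless w {[]}    _ = refl
  hash∷body-borderless w {_ ∷ _} (_ , ([] , []≢[] , _)) = ⊥-elim ([]≢[] refl)
  hash∷body-borderless w {e ∷ u} ((_ , _ , x≡eu) , (_ ∷ u₀ , _ , x≡u₀eu)) =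
    ⊥-elim (<F-irrefl (subst (_<F hash) (sym (∷-injectiveˡ x≡eu))
                              (body-<F-hash w u₀ (∷-injectiveʳ x≡u₀eu))))

  letter∷body-¬invLyndon : ∀ a w → ¬ InvLyndon (letter a ∷ body w)
  letter∷body-¬invLyndon a w (_ , suffix≺) =
    ⊏⇒¬≻ ([] , letter a , dollar , body w , [] , let<$ , refl , refl)
         (suffix≺ (letter a ∷ map letter w) [ dollar ] (λ ()) (λ ()) refl)

  drop-body-¬invLyndon : ∀ k w → suc k < length (body w) → ¬ InvLyndon (drop k (body w))
  drop-body-¬invLyndon zero    (a ∷ w) _         = letter∷body-¬invLyndon a w
  drop-body-¬invLyndon (suc k) (_ ∷ w) (s≤s k<n) = drop-body-¬invLyndon k w k<n
  drop-body-¬invLyndon zero    []      (s≤s ())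
  drop-body-¬invLyndon (suc k) []      (s≤s ())

  next-greater-first : ∀ w m b → IsInvLyndonArray (hash ∷ body w) 1 m →
    IsLongestBorderLength (sub (hash ∷ body w) 1 m) b → 1 + m ∸ b ≡ suc (length (hash ∷ body w))
  next-greater-first w m _ (_ , m≤N , _ , maximal) ((u , border , refl) , _) =
    cong₂ (λ k l → 1 + k ∸ l) m≡n (hash∷body-borderless w border′)
    where
      x : Word
      x = hash ∷ body w

      N≡n : length x ∸ 1 + 1 ≡ length x
      N≡n = +-comm (length (body w)) 1

      m≡n : m ≡ length x
      m≡n = trans (≤-antisym m≤N (maximal _ (m≤n+m 1 _) ≤-refl
              (subst InvLyndon (sym (take-all _ x (≤-reflexive (sym N≡n)))) (hash∷body-invLyndon w))))
            N≡n

      border′ : Border u x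
      border′ = subst (Border u) (trans (cong (λ k → take k x) m≡n) (take-all (length x) x ≤-refl)) border

  next-greater-framed : ∀ w i → 1 ≤ i → i ≤ length (hash ∷ body w) → ∀ m b j →
    IsInvLyndonArray (hash ∷ body w) i m → IsLongestBorderLength (sub (hash ∷ body w) i m) b →
    IsNextGreater (hash ∷ body w) i j → j ≡ i + m ∸ b
  next-greater-framed w _ _ _ m b j arr border (inj₁ (inj₁ refl , j≡)) =
    trans j≡ (sym (next-greater-first w m b arr border))
  next-greater-framed w _ _ _ m b j arr border (inj₁ (inj₂ refl , j≡)) =
    trans j≡ (sym (next-greater-last (hash ∷ body w) m b arr border))
  next-greater-framed w (suc (suc k)) 1≤i i≤n m b j arr border
                      (inj₂ (_ , s≤s i<n , i<j , _ , next , minimal)) =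
    next-greater≡period _ _ m b j 1≤i i≤n (drop-body-¬invLyndon k w i<n) arr border i<j next minimal
  next-greater-framed w (suc zero) _ _ _ _ _ _ _ (inj₂ (s≤s () , _))

lemma7 : {A : Set} (_<_ : A → A → Set) → IsStrictTotalOrder _≡_ _<_ →
    (x : Words.Word _<_) → Words.Framed _<_ x →
    (i : ℕ) → 1 ≤ i → i ≤ length x →
    (m b j : ℕ) →
    Words.IsInvLyndonArray _<_ x i m →
    Words.IsLongestBorderLength _<_ (Words.sub _<_ x i m) b →
    Words.IsNextGreater _<_ x i j →
    j ≡ i + m ∸ b
lemma7 _<_ sto _ (w , refl) = InverseLyndon.next-greater-framed _<_ sto w
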